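{- Let $(j_n)_{n\ge 0}$ be defined by $j_0=0$, $j_{2k}=j_k$, $j_{2k+1}=(-1)^k$, and $s_n=1+\sum_{0\le k\le n}j_k$. Let $a_0=0$ and let $(a_n)_{n\ge1}$ be the increasing sequence of positive integers whose odd part is of the form $4k+1$. Then: (i) For an integer $n\ge 0$, $a_{n+1}-a_n=2$ if and only if there exists an integer $r\ge 0$ with $n=8r+\frac{1+s_{16r+2}}{2}$; in that case $a_n=16r+2$, and such an $r$ is unique, namely $r=\lfloor a_n/16\rfloor$. (ii) Let $\psi(r)=8r+\frac{1+s_{16r+2}}{2}$ for $r\ge 0$ (so that $a_{\psi(r)}=16r+2$). Then $\psi$ is increasing on $r\ge 0$, and $|\psi(r)-\psi(r')|\ge 7$ for all $r\ne r'$.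
   Context: The odd part of a positive integer $m$ is $m/2^v$ with $2^v$ the largest power of $2$ dividing $m$. -}

module Defs where

open import Data.Nat as ℕ using (ℕ; zero; suc; _^_)
open import Data.Nat.DivMod using (_/_; _%_)
open import Data.Integer as ℤ using (ℤ; +_; -_)
open import Data.Integer.DivMod using (_/ℕ_)
open import Data.Product using (Σ; ∃; _×_)
open import Relation.Binary.PropositionalEquality using (_≡_)

minusOnePow : ℕ → ℤ
minusOnePow zero = + 1
minusOnePow (suc k) = - minusOnePow k

-- j with fuel: j_0 = 0, j_{2k} = j_k, j_{2k+1} = (-1)^k.
-- Fuel n suffices for argument n since n/2 < n for n > 0 and j 0 = 0.
jF : ℕ → ℕ → ℤ
jF zero n = + 0
jF (suc f) n with n % 2
... | zero  = jF f (n / 2)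
... | suc _ = minusOnePow (n / 2)

j : ℕ → ℤ
j n = jF n n

sumJ : ℕ → ℤ
sumJ zero = j zero
sumJ (suc n) = sumJ n ℤ.+ j (suc n)

s : ℕ → ℤ
s n = + 1 ℤ.+ sumJ n

-- ψ(r) = 8r + (1 + s_{16r+2}) / 2   (the division is exact; floor division used)
ψ : ℕ → ℤ
ψ r = + (8 ℕ.* r) ℤ.+ ((+ 1 ℤ.+ s (16 ℕ.* r ℕ.+ 2)) /ℕ 2)

OddPart : ℕ → ℕ → Set
OddPart m o = ∃ λ v → (m ≡ 2 ^ v ℕ.* o) × (o % 2 ≡ 1)

Good : ℕ → Set
Good m = ∃ λ o → OddPart m o × (∃ λ k → o ≡ 4 ℕ.* k ℕ.+ 1)

module Submission where

-- Every m ≥ 1 has j_m = (-1)^k where 2^v (2k+1) is its odd-part decomposition, so j_m = 1 exactly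
-- for the "good" m (odd part ≡ 1 mod 4) and j_m = -1 otherwise. Hence, writing g(n) for the number
-- of good integers in [1, n], s_n = 1 + 2 g(n) - n and ψ(r) = g(16r+2); as a enumerates the good
-- integers, g(a_n) = n. A gap a_{n+1} - a_n = 2 means that a_n and a_n + 2 are good but a_n + 1 is
-- not, and chasing the residues of a_n modulo 2, 4, 8, 16 shows that this happens exactly when
-- a_n ≡ 2 (mod 16). Seven of 16r+3, …, 16r+18 are good, so ψ grows by at least 7 per step.

open import Defs
open import Data.Nat as ℕ
  using (ℕ; zero; suc; _<_; _≤_; _+_; _*_; _^_; _∸_; z≤n; s≤s; _≤′_; ≤′-refl; ≤′-step)
open import Data.Nat.Properties
open import Data.Nat.DivMod
  using (_/_; _%_; m*n/n≡m; m*n%n≡0; m<n⇒m/n≡0; [m+kn]%n≡m%n; m/n<m; +-distrib-/-∣ʳ)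
open import Data.Nat.Divisibility using (divides-refl)
open import Data.Nat.Induction using (<-rec)
open import Data.Nat.Tactic.RingSolver using (solve-∀; solve)
open import Data.Integer as ℤ using (ℤ; +_; -_; ∣_∣)
import Data.Integer.Properties as ℤ
open import Data.Integer.DivMod using (_/ℕ_; [n/ℕd]*d≤n; n<s[n/ℕd]*d)
import Data.Integer.Tactic.RingSolver as ℤ
open import Data.List.Base using (_∷_; [])
open import Data.Product using (∃; ∃₂; ∃-syntax; _×_; _,_; proj₁)
open import Data.Sum using (_⊎_; inj₁; inj₂)
open import Data.Empty using (⊥-elim)
open import Function.Base using (_$_; _∘_)
open import Function.Bundles using (_⇔_; mk⇔)
open import Relation.Nullary using (yes; no)
open import Relation.Nullary.Decidable using (True; toWitness; from-yes)
open import Relation.Binary.Definitions using (tri<; tri≈; tri>)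
open import Relation.Binary.PropositionalEquality
open ≡-Reasoning

even⊎odd : ∀ n → ∃[ k ] (n ≡ 2 * k ⊎ n ≡ 1 + 2 * k)
even⊎odd zero = 0 , inj₁ refl
even⊎odd (suc n) with even⊎odd n
... | k , inj₁ n≡2k   = k , inj₂ (cong suc n≡2k)
... | k , inj₂ n≡1+2k = suc k , inj₁ (trans (cong suc n≡1+2k) (solve (k ∷ [])))

[2k]%2≡0 : ∀ k → 2 * k % 2 ≡ 0
[2k]%2≡0 k = trans (cong (_% 2) (*-comm 2 k)) (m*n%n≡0 k 2)

[2k]/2≡k : ∀ k → 2 * k / 2 ≡ k
[2k]/2≡k k = trans (cong (_/ 2) (*-comm 2 k)) (m*n/n≡m k 2)

[1+2k]%2≡1 : ∀ k → (1 + 2 * k) % 2 ≡ 1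
[1+2k]%2≡1 k = trans (cong (λ t → (1 + t) % 2) (*-comm 2 k)) ([m+kn]%n≡m%n 1 k 2)

[1+2k]/2≡k : ∀ k → (1 + 2 * k) / 2 ≡ k
[1+2k]/2≡k k = begin
  (1 + 2 * k) / 2    ≡⟨ cong (λ t → (1 + t) / 2) (*-comm 2 k) ⟩
  (1 + k * 2) / 2    ≡⟨ +-distrib-/-∣ʳ 1 {d = 2} (divides-refl k) ⟩
  0 + k * 2 / 2      ≡⟨ m*n/n≡m k 2 ⟩
  k                  ∎

[n*q+o]/n≡q : ∀ n q o .{{_ : ℕ.NonZero n}} → o < n → (n * q + o) / n ≡ q
[n*q+o]/n≡q n q o o<n = begin
  (n * q + o) / n    ≡⟨ cong (_/ n) (trans (+-comm (n * q) o) (cong (_+_ o) (*-comm n q))) ⟩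
  (o + q * n) / n    ≡⟨ +-distrib-/-∣ʳ o (divides-refl q) ⟩
  o / n + q * n / n  ≡⟨ cong₂ _+_ (m<n⇒m/n≡0 o<n) (m*n/n≡m q n) ⟩
  q                  ∎

[i*d]/ℕd≡i : ∀ i d .{{_ : ℕ.NonZero d}} → (i ℤ.* + d) /ℕ d ≡ i
[i*d]/ℕd≡i i d@(suc _) = ℤ.≤-antisym q≤i i≤q
  where
  q : ℤ
  q = (i ℤ.* + d) /ℕ d
  q≤i : q ℤ.≤ i
  q≤i = ℤ.*-cancelʳ-≤-pos q i (+ d) ([n/ℕd]*d≤n (i ℤ.* + d) d)
  i≤q : i ℤ.≤ q
  i≤q = subst (i ℤ.≤_) (ℤ.pred-suc q)
          (ℤ.i<j⇒i≤pred[j] {j = ℤ.suc q} (ℤ.*-cancelʳ-<-nonNeg (+ d) (n<s[n/ℕd]*d (i ℤ.* + d) d)))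

d+m≤n⇒d≤∣m-n∣ : ∀ {d m n} → d + m ≤ n → d ≤ ∣ + m ℤ.- + n ∣
d+m≤n⇒d≤∣m-n∣ {d} {m} {n} d+m≤n = subst (d ≤_) n∸m≡∣m-n∣ (m+n≤o⇒m≤o∸n d d+m≤n)
  where n∸m≡∣m-n∣ : n ∸ m ≡ ∣ + m ℤ.- + n ∣
        n∸m≡∣m-n∣ = sym (trans (cong ∣_∣ (ℤ.[+m]-[+n]≡m⊖n m n)) (ℤ.∣⊖∣-≤ (m+n≤o⇒n≤o d d+m≤n)))

-1≢1 : - + 1 ≢ + 1
-1≢1 ()

minusOnePow-even : ∀ u → minusOnePow (2 * u) ≡ + 1
minusOnePow-even zero = refl
minusOnePow-even (suc u) = begin
  minusOnePow (2 * suc u)    ≡⟨ cong minusOnePow (*-distribˡ-+ 2 1 u) ⟩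
  - - minusOnePow (2 * u)    ≡⟨ ℤ.neg-involutive _ ⟩
  minusOnePow (2 * u)        ≡⟨ minusOnePow-even u ⟩
  + 1                        ∎

minusOnePow-odd : ∀ u → minusOnePow (1 + 2 * u) ≡ - + 1
minusOnePow-odd u = cong -_ (minusOnePow-even u)

minusOnePow≡±1 : ∀ k → minusOnePow k ≡ + 1 ⊎ minusOnePow k ≡ - + 1
minusOnePow≡±1 k with even⊎odd k
... | u , inj₁ refl = inj₁ (minusOnePow-even u)
... | u , inj₂ refl = inj₂ (minusOnePow-odd u)

minusOnePow≡1⇒even : ∀ k → minusOnePow k ≡ + 1 → ∃[ u ] k ≡ 2 * u
minusOnePow≡1⇒even k eq with even⊎odd k
... | u , inj₁ k≡2u = u , k≡2u
... | u , inj₂ refl with () ← trans (sym (minusOnePow-odd u)) eq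

oddPart-decomposition : ∀ m → 1 ≤ m → ∃₂ λ v k → m ≡ 2 ^ v * (1 + 2 * k)
oddPart-decomposition = <-rec _ decompose
  where
  decompose : ∀ m → (∀ {m′} → m′ < m → 1 ≤ m′ → ∃₂ λ v k → m′ ≡ 2 ^ v * (1 + 2 * k)) →
              1 ≤ m → ∃₂ λ v k → m ≡ 2 ^ v * (1 + 2 * k)
  decompose m rec 1≤m with even⊎odd m
  ... | k , inj₂ refl = 0 , k , sym (+-identityʳ _)
  ... | zero , inj₁ refl = ⊥-elim (1+n≰n 1≤m)
  ... | suc k , inj₁ refl with rec (m<m+n (suc k) (s≤s z≤n)) (s≤s z≤n)
  ... | v , u , k≡ = suc v , u , trans (cong (2 *_) k≡) (sym (*-assoc 2 (2 ^ v) (1 + 2 * u)))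

jF-zero : ∀ f → jF f 0 ≡ + 0
jF-zero zero    = refl
jF-zero (suc f) = jF-zero f

jF-fuel-irrelevant : ∀ f g n → n ≤ f → n ≤ g → jF f n ≡ jF g n
jF-fuel-irrelevant f g zero _ _ = trans (jF-zero f) (sym (jF-zero g))
jF-fuel-irrelevant (suc f) (suc g) (suc n) n<f n<g with suc n % 2
... | zero  = jF-fuel-irrelevant f g (suc n / 2) (≤-pred (≤-trans half<n n<f)) (≤-pred (≤-trans half<n n<g))
  where half<n : suc n / 2 < suc n
        half<n = m/n<m (suc n) 2 (s≤s (s≤s z≤n))
... | suc _ = refl

j-unfold-even : ∀ n → n % 2 ≡ 0 → j n ≡ j (n / 2)
j-unfold-even zero    _ = refl
j-unfold-even (suc n) even rewrite even =
  jF-fuel-irrelevant n (suc n / 2) (suc n / 2) (≤-pred (m/n<m (suc n) 2 (s≤s (s≤s z≤n)))) ≤-refl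

j-unfold-odd : ∀ n → n % 2 ≡ 1 → j n ≡ minusOnePow (n / 2)
j-unfold-odd (suc n) odd rewrite odd = refl

j-double : ∀ k → j (2 * k) ≡ j k
j-double k = trans (j-unfold-even (2 * k) ([2k]%2≡0 k)) (cong j ([2k]/2≡k k))

j-odd : ∀ k → j (1 + 2 * k) ≡ minusOnePow k
j-odd k = trans (j-unfold-odd (1 + 2 * k) ([1+2k]%2≡1 k)) (cong minusOnePow ([1+2k]/2≡k k))

j-3+2k : ∀ k → j (3 + 2 * k) ≡ - j (1 + 2 * k)
j-3+2k k = begin
  j (3 + 2 * k)        ≡⟨ cong (λ t → j (suc t)) (*-distribˡ-+ 2 1 k) ⟨
  j (1 + 2 * suc k)    ≡⟨ j-odd (suc k) ⟩
  - minusOnePow k      ≡⟨ cong -_ (j-odd k) ⟨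
  - j (1 + 2 * k)      ∎

j-2^v* : ∀ v o → j (2 ^ v * o) ≡ j o
j-2^v* zero    o = cong j (+-identityʳ o)
j-2^v* (suc v) o = begin
  j (2 * 2 ^ v * o)     ≡⟨ cong j (*-assoc 2 (2 ^ v) o) ⟩
  j (2 * (2 ^ v * o))   ≡⟨ j-double (2 ^ v * o) ⟩
  j (2 ^ v * o)         ≡⟨ j-2^v* v o ⟩
  j o                   ∎

j-oddPart : ∀ m v k → m ≡ 2 ^ v * (1 + 2 * k) → j m ≡ minusOnePow k
j-oddPart _ v k refl = trans (j-2^v* v (1 + 2 * k)) (j-odd k)

j≡1-at : ∀ m v k → m ≡ 2 ^ v * (4 * k + 1) → j m ≡ + 1
j≡1-at m v k refl = trans (j-oddPart _ v (2 * k) (cong (2 ^ v *_) (solve (k ∷ [])))) (minusOnePow-even k)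

j≡-1-at : ∀ m v k → m ≡ 2 ^ v * (4 * k + 3) → j m ≡ - + 1
j≡-1-at m v k refl = trans (j-oddPart _ v (1 + 2 * k) (cong (2 ^ v *_) (solve (k ∷ [])))) (minusOnePow-odd k)

j≡±1 : ∀ m → 1 ≤ m → j m ≡ + 1 ⊎ j m ≡ - + 1
j≡±1 m 1≤m with oddPart-decomposition m 1≤m
... | v , k , m≡ rewrite j-oddPart m v k m≡ = minusOnePow≡±1 k

Good⇒j≡1 : ∀ m → Good m → j m ≡ + 1
Good⇒j≡1 m (_ , (v , m≡ , _) , k , refl) = j≡1-at m v k m≡

j≡1⇒Good : ∀ m → 1 ≤ m → j m ≡ + 1 → Good m
j≡1⇒Good m 1≤m jm≡1 with oddPart-decomposition m 1≤m
... | v , k , refl with minusOnePow≡1⇒even k (trans (sym (j-oddPart _ v k refl)) jm≡1)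
... | u , refl = 1 + 2 * (2 * u) , (v , refl , [1+2k]%2≡1 (2 * u)) , u , solve (u ∷ [])

j-16r+2 : ∀ r → j (16 * r + 2) ≡ + 1
j-16r+2 r = j≡1-at (16 * r + 2) 1 (2 * r) (solve (r ∷ []))

j-16r+3 : ∀ r → j (suc (16 * r + 2)) ≡ - + 1
j-16r+3 r = j≡-1-at (suc (16 * r + 2)) 0 (4 * r) (solve (r ∷ []))

j-16r+4 : ∀ r → j (suc (suc (16 * r + 2))) ≡ + 1
j-16r+4 r = j≡1-at (suc (suc (16 * r + 2))) 2 r (solve (r ∷ []))

good-bad-good⇒≡2[mod16] : ∀ m → j m ≡ + 1 → j (1 + m) ≢ + 1 → j (2 + m) ≡ + 1 →
                          ∃[ r ] m ≡ 16 * r + 2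
good-bad-good⇒≡2[mod16] m jm jm+1 jm+2 with even⊎odd m
... | k , inj₂ refl with () ← trans (sym jm+2) (trans (j-3+2k k) (cong -_ jm))
... | k , inj₁ refl with even⊎odd k
...   | u , inj₁ refl = ⊥-elim (jm+1 (trans (j-odd (2 * u)) (minusOnePow-even u)))
...   | u , inj₂ refl with minusOnePow≡1⇒even u (trans (sym (trans (j-double (1 + 2 * u)) (j-odd u))) jm)
...     | w , refl with minusOnePow≡1⇒even w
                          (trans (sym (j-oddPart (2 + m) 2 w (solve (w ∷ [])))) jm+2)
...       | r , refl = r , solve (r ∷ [])

countGood : ℕ → ℕ
countGood zero = 0
countGood (suc n) with j (suc n) ℤ.≟ + 1
... | yes _ = suc (countGood n)
... | no _  = countGood n

countGood-suc-good : ∀ n → j (suc n) ≡ + 1 → countGood (suc n) ≡ suc (countGood n)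
countGood-suc-good n good with j (suc n) ℤ.≟ + 1
... | yes _  = refl
... | no bad = ⊥-elim (bad good)

countGood-suc-bad : ∀ n → j (suc n) ≢ + 1 → countGood (suc n) ≡ countGood n
countGood-suc-bad n bad with j (suc n) ℤ.≟ + 1
... | yes good = ⊥-elim (bad good)
... | no _     = refl

countGood-suc-≤ : ∀ n → countGood n ≤ countGood (suc n)
countGood-suc-≤ n with j (suc n) ℤ.≟ + 1
... | yes _ = n≤1+n _
... | no _  = ≤-refl

countGood-mono : ∀ {m n} → m ≤ n → countGood m ≤ countGood n
countGood-mono m≤n = go (≤⇒≤′ m≤n)
  where go : ∀ {m n} → m ≤′ n → countGood m ≤ countGood n
        go ≤′-refl             = ≤-refl
        go (≤′-step {n} m≤n) = ≤-trans (go m≤n) (countGood-suc-≤ n)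

countGood-gain : ∀ {m n} → m < n → j n ≡ + 1 → countGood m < countGood n
countGood-gain {m} {suc n} (s≤s m≤n) good =
  subst (countGood m <_) (sym (countGood-suc-good n good)) (s≤s (countGood-mono m≤n))

countGood-flat : ∀ {m n} → m ≤ n → (∀ k → m < k → k ≤ n → j k ≢ + 1) → countGood n ≡ countGood m
countGood-flat m≤n = go (≤⇒≤′ m≤n)
  where go : ∀ {m n} → m ≤′ n → (∀ k → m < k → k ≤ n → j k ≢ + 1) → countGood n ≡ countGood m
        go ≤′-refl             _      = refl
        go (≤′-step {n} m≤n) noGood = trans
          (countGood-suc-bad n (noGood (suc n) (s≤s (≤′⇒≤ m≤n)) ≤-refl))
          (go m≤n (λ k m<k k≤n → noGood k m<k (m≤n⇒m≤1+n k≤n)))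

countGood-next : ∀ {m n} → m < n → (∀ k → m < k → k < n → j k ≢ + 1) → j n ≡ + 1 →
                 countGood n ≡ suc (countGood m)
countGood-next {m} {suc n} (s≤s m≤n) noGood good = begin
  countGood (suc n)    ≡⟨ countGood-suc-good n good ⟩
  suc (countGood n)    ≡⟨ cong suc (countGood-flat m≤n (λ k m<k k≤n → noGood k m<k (s≤s k≤n))) ⟩
  suc (countGood m)    ∎

sumJ-countGood : ∀ n → sumJ n ℤ.+ + n ≡ + (countGood n + countGood n)
sumJ-countGood zero = refl
sumJ-countGood (suc n) with j (suc n) ℤ.≟ + 1 | j≡±1 (suc n) (s≤s z≤n)
... | yes _    | inj₁ good rewrite good = begin
  sumJ n ℤ.+ + 1 ℤ.+ + suc n                  ≡⟨ ℤ-step (sumJ n) (+ n) ⟩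
  sumJ n ℤ.+ + n ℤ.+ + 2                      ≡⟨ cong (ℤ._+ + 2) (sumJ-countGood n) ⟩
  + (countGood n + countGood n + 2)           ≡⟨ cong +_ (ℕ-step (countGood n)) ⟩
  + (suc (countGood n) + suc (countGood n))   ∎
  where ℤ-step : ∀ S i → S ℤ.+ + 1 ℤ.+ (+ 1 ℤ.+ i) ≡ S ℤ.+ i ℤ.+ + 2
        ℤ-step = ℤ.solve-∀
        ℕ-step : ∀ g → g + g + 2 ≡ suc g + suc g
        ℕ-step = solve-∀
... | yes good | inj₂ bad  with () ← trans (sym good) bad
... | no bad   | inj₁ good = ⊥-elim (bad good)
... | no _     | inj₂ bad rewrite bad = trans (ℤ-step (sumJ n) (+ n)) (sumJ-countGood n)
  where ℤ-step : ∀ S i → S ℤ.+ - + 1 ℤ.+ (+ 1 ℤ.+ i) ≡ S ℤ.+ i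
        ℤ-step = ℤ.solve-∀

ψ≡countGood : ∀ r → ψ r ≡ + countGood (16 * r + 2)
ψ≡countGood r = begin
  e ℤ.+ (+ 1 ℤ.+ s x) /ℕ 2              ≡⟨ cong (λ t → e ℤ.+ t /ℕ 2) 1+s≡[g-e]*2 ⟩
  e ℤ.+ ((+ g ℤ.- e) ℤ.* + 2) /ℕ 2      ≡⟨ cong (λ t → e ℤ.+ t) ([i*d]/ℕd≡i (+ g ℤ.- e) 2) ⟩
  e ℤ.+ (+ g ℤ.- e)                     ≡⟨ cancel e (+ g) ⟩
  + g                                   ∎
  where
  x g : ℕ
  x = 16 * r + 2
  g = countGood x
  e : ℤ
  e = + (8 * r)
  +x≡e*2+2 : + x ≡ e ℤ.* + 2 ℤ.+ + 2
  +x≡e*2+2 = cong (ℤ._+ + 2) (trans (cong +_ (trans (*-assoc 2 8 r) (*-comm 2 (8 * r)))) (ℤ.pos-* (8 * r) 2))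
  cancel : ∀ e g → e ℤ.+ (g ℤ.- e) ≡ g
  cancel = ℤ.solve-∀
  1+s≡[g-e]*2 : + 1 ℤ.+ s x ≡ (+ g ℤ.- e) ℤ.* + 2
  1+s≡[g-e]*2 = begin
    + 1 ℤ.+ (+ 1 ℤ.+ sumJ x)                        ≡⟨ ring₁ (sumJ x) e ⟩
    sumJ x ℤ.+ (e ℤ.* + 2 ℤ.+ + 2) ℤ.- e ℤ.* + 2    ≡⟨ cong (λ t → sumJ x ℤ.+ t ℤ.- e ℤ.* + 2) +x≡e*2+2 ⟨
    sumJ x ℤ.+ + x ℤ.- e ℤ.* + 2                    ≡⟨ cong (ℤ._- e ℤ.* + 2) (sumJ-countGood x) ⟩
    + g ℤ.+ + g ℤ.- e ℤ.* + 2                       ≡⟨ ring₂ (+ g) e ⟩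
    (+ g ℤ.- e) ℤ.* + 2                             ∎
    where
    ring₁ : ∀ S e → + 1 ℤ.+ (+ 1 ℤ.+ S) ≡ S ℤ.+ (e ℤ.* + 2 ℤ.+ + 2) ℤ.- e ℤ.* + 2
    ring₁ = ℤ.solve-∀
    ring₂ : ∀ g e → g ℤ.+ g ℤ.- e ℤ.* + 2 ≡ (g ℤ.- e) ℤ.* + 2
    ring₂ = ℤ.solve-∀

countGood-gap : ∀ r → 7 + countGood (16 * r + 2) ≤ countGood (16 * r + 18)
countGood-gap r =
  step 17 18 1 (2 * r + 2) (solve (r ∷ [])) $
  step 13 17 0 (4 * r + 4) (solve (r ∷ [])) $
  step 10 13 0 (4 * r + 3) (solve (r ∷ [])) $
  step 9  10 1 (2 * r + 1) (solve (r ∷ [])) $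
  step 5  9  0 (4 * r + 2) (solve (r ∷ [])) $
  step 4  5  0 (4 * r + 1) (solve (r ∷ [])) $
  step 2  4  2 r           (solve (r ∷ [])) $
  ≤-refl
  where
  step : ∀ {k} d e v q {d<e : True (d <? e)} → 16 * r + e ≡ 2 ^ v * (4 * q + 1) →
         k ≤ countGood (16 * r + d) → suc k ≤ countGood (16 * r + e)
  step d e v q {d<e} eq k≤ =
    ≤-trans (s≤s k≤) (countGood-gain (+-monoʳ-< (16 * r) (toWitness d<e)) (j≡1-at _ v q eq))

countGood-spread : ∀ {r r′} → r < r′ → 7 + countGood (16 * r + 2) ≤ countGood (16 * r′ + 2)
countGood-spread {r} {r′} r<r′ = ≤-trans (countGood-gap r) (countGood-mono 16r+18≤16r′+2)
  where regroup : ∀ r → 16 * suc r + 2 ≡ 16 * r + 18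
        regroup = solve-∀
        16r+18≤16r′+2 : 16 * r + 18 ≤ 16 * r′ + 2
        16r+18≤16r′+2 = subst (_≤ 16 * r′ + 2) (regroup r) (+-monoˡ-≤ 2 (*-monoʳ-≤ 16 r<r′))

ψ-increasing : ∀ r r′ → r < r′ → ψ r ℤ.< ψ r′
ψ-increasing r r′ r<r′ = subst₂ ℤ._<_ (sym (ψ≡countGood r)) (sym (ψ≡countGood r′))
                                  (ℤ.+<+ (≤-trans (s≤s (m≤n+m _ 6)) (countGood-spread r<r′)))

ψ-separated : ∀ r r′ → r ≢ r′ → 7 ≤ ∣ ψ r ℤ.- ψ r′ ∣
ψ-separated r r′ r≢r′ rewrite ψ≡countGood r | ψ≡countGood r′ with <-cmp r r′
... | tri< r<r′ _ _ = d+m≤n⇒d≤∣m-n∣ (countGood-spread r<r′)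
... | tri≈ _ r≡r′ _ = ⊥-elim (r≢r′ r≡r′)
... | tri> _ _ r′<r = subst (7 ≤_) (ℤ.∣i-j∣≡∣j-i∣ (+ countGood (16 * r′ + 2)) (+ countGood (16 * r + 2)))
                            (d+m≤n⇒d≤∣m-n∣ (countGood-spread r′<r))

module Enumeration
  (a : ℕ → ℕ) (a-0 : a 0 ≡ 0) (a-< : ∀ n → a n < a (suc n))
  (a-good : ∀ n → 1 ≤ n → Good (a n)) (a-onto : ∀ m → 1 ≤ m → Good m → ∃ λ n → a n ≡ m)
  where

  a-mono : ∀ {m n} → m ≤ n → a m ≤ a n
  a-mono m≤n = go (≤⇒≤′ m≤n)
    where go : ∀ {m n} → m ≤′ n → a m ≤ a n
          go ≤′-refl             = ≤-refl
          go (≤′-step {n} m≤n) = ≤-trans (go m≤n) (<⇒≤ (a-< n))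

  a-cancel-< : ∀ {m n} → a m < a n → m < n
  a-cancel-< {m} {n} am<an with m <? n
  ... | yes m<n = m<n
  ... | no m≮n  = ⊥-elim (≤⇒≯ (a-mono (≮⇒≥ m≮n)) am<an)

  j-a : ∀ n → 1 ≤ n → j (a n) ≡ + 1
  j-a n 1≤n = Good⇒j≡1 (a n) (a-good n 1≤n)

  no-good-between : ∀ n m → a n < m → m < a (suc n) → j m ≢ + 1
  no-good-between n m an<m m<an+1 good with a-onto m (m<n⇒0<n an<m) (j≡1⇒Good m (m<n⇒0<n an<m) good)
  ... | k , refl = ≤⇒≯ (≤-pred (a-cancel-< m<an+1)) (a-cancel-< an<m)

  countGood∘a : ∀ n → countGood (a n) ≡ n
  countGood∘a zero    = cong countGood a-0
  countGood∘a (suc n) = trans (countGood-next (a-< n) (no-good-between n) (j-a (suc n) (s≤s z≤n)))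
                              (cong suc (countGood∘a n))

  a∘countGood : ∀ m → 1 ≤ m → j m ≡ + 1 → a (countGood m) ≡ m
  a∘countGood m 1≤m good with a-onto m 1≤m (j≡1⇒Good m 1≤m good)
  ... | n , refl = cong a (countGood∘a n)

  module _ {n} r (n≡ψr : + n ≡ ψ r) where

    x : ℕ
    x = 16 * r + 2

    n≡countGood : n ≡ countGood x
    n≡countGood = ℤ.+-injective (trans n≡ψr (ψ≡countGood r))

    a-at-ψ : a n ≡ x
    a-at-ψ = trans (cong a n≡countGood) (a∘countGood x (≤-trans (s≤s z≤n) (m≤n+m 2 (16 * r))) (j-16r+2 r))

    countGood-x+2 : countGood (2 + x) ≡ suc n
    countGood-x+2 = begin
      countGood (2 + x)         ≡⟨ countGood-suc-good (suc x) (j-16r+4 r) ⟩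
      suc (countGood (suc x))   ≡⟨ cong suc (countGood-suc-bad x (-1≢1 ∘ trans (sym (j-16r+3 r)))) ⟩
      suc (countGood x)         ≡⟨ cong suc n≡countGood ⟨
      suc n                     ∎

    a-suc-at-ψ : a (suc n) ≡ a n + 2
    a-suc-at-ψ = begin
      a (suc n)               ≡⟨ cong a countGood-x+2 ⟨
      a (countGood (2 + x))   ≡⟨ a∘countGood (2 + x) (s≤s z≤n) (j-16r+4 r) ⟩
      2 + x                   ≡⟨ +-comm 2 x ⟩
      x + 2                   ≡⟨ cong (_+ 2) a-at-ψ ⟨
      a n + 2                 ∎

  gap-2⇒bad-good : ∀ n → a (suc n) ≡ a n + 2 → j (1 + a n) ≢ + 1 × j (2 + a n) ≡ + 1
  gap-2⇒bad-good n an+1≡an+2 =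
      no-good-between n (suc (a n)) ≤-refl (subst (suc (a n) <_) (sym an+1≡2+an) ≤-refl)
    , subst (λ m → j m ≡ + 1) an+1≡2+an (j-a (suc n) (s≤s z≤n))
    where an+1≡2+an : a (suc n) ≡ 2 + a n
          an+1≡2+an = trans an+1≡an+2 (+-comm (a n) 2)

  gap-2⇒at-ψ : ∀ n → a (suc n) ≡ a n + 2 → ∃ λ r → + n ≡ ψ r
  gap-2⇒at-ψ zero a1≡a0+2 =
    ⊥-elim (proj₁ (gap-2⇒bad-good 0 a1≡a0+2) (subst (λ m → j (1 + m) ≡ + 1) (sym a-0) refl))
  gap-2⇒at-ψ n@(suc _) an+1≡an+2 with gap-2⇒bad-good n an+1≡an+2
  ... | bad , good with good-bad-good⇒≡2[mod16] (a n) (j-a n (s≤s z≤n)) bad good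
  ... | r , an≡16r+2 = r , (begin
    + n                         ≡⟨ cong +_ (countGood∘a n) ⟨
    + countGood (a n)           ≡⟨ cong (λ m → + countGood m) an≡16r+2 ⟩
    + countGood (16 * r + 2)    ≡⟨ ψ≡countGood r ⟨
    ψ r                         ∎)

proposition8 :
    (a : ℕ → ℕ) →
    a 0 ≡ 0 →
    (∀ n → a n < a (suc n)) →
    (∀ n → 1 ≤ n → Good (a n)) →
    (∀ m → 1 ≤ m → Good m → ∃ λ n → a n ≡ m) →
    ((∀ n → (a (suc n) ≡ a n + 2) ⇔ (∃ λ r → + n ≡ ψ r))
     × (∀ n r → + n ≡ ψ r → a n ≡ 16 * r + 2)
     × (∀ n r → + n ≡ ψ r → r ≡ a n / 16))
    × ((∀ r r′ → r < r′ → ψ r ℤ.< ψ r′)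
     × (∀ r r′ → r ≢ r′ → 7 ℕ.≤ ∣ ψ r ℤ.- ψ r′ ∣))
proposition8 a a-0 a-< a-good a-onto =
    ( (λ n → mk⇔ (gap-2⇒at-ψ n) (λ (r , n≡ψr) → a-suc-at-ψ r n≡ψr))
    , (λ _ → a-at-ψ)
    , (λ n r n≡ψr → sym (trans (cong (_/ 16) (a-at-ψ r n≡ψr)) ([n*q+o]/n≡q 16 r 2 (from-yes (2 <? 16)))))
    )
  , ψ-increasing
  , ψ-separated
  where open Enumeration a a-0 a-< a-good a-onto
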